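{- If $(a_1,\ldots,a_n)$ is an ev-sequence of weight $x$, then $\mathrm{st}(a_1,\ldots,a_n)\in\mathrm{ev}(x)$; that is, for every graph game board $h$, $\mathrm{val}(\mathrm{st}(a_1,\ldots,a_n)\oplus h)=\mathrm{val}(h)-x$ if $h$ is even and $=\mathrm{val}(h)+x$ if $h$ is odd.
   Context: A graph game board is a pair $g=(G,A)$ where $G$ is a finite simple graph whose vertices carry real weights $\mathrm{wt}(v)$ and $A$ is a set of vertices (available). A component is unbroached if it contains no vertex of $A$. $g\backslash v$: delete $v$ and its edges and replace $A$ by $(A\cup\{$neighbours of $v\})\backslash\{v\}$. Legal initial moves: vertices of $A$ and all vertices of unbroached components. Players alternately choose legal moves (Player One first) until no vertices remain; Player One's outcome is the weight he took minus the weight taken by Player Two; $\mathrm{val}(g)$ is this under optimal play. $h$ is even/odd according to its number of vertices; $\oplus$ is disjoint union with united available sets. $\mathrm{st}(a_1,\ldots,a_n)$ is a path $v_1,\ldots,v_n$ with $\mathrm{wt}(v_i)=a_i$ and available set $\{v_1\}$. A sequence $(a_1,\ldots,a_n)$ is an ev-sequence if $n$ is even and $\sum_{i=1}^{2k}(-1)^{i-1}a_i\le0$ for $1\le k\le n/2$; its weight is $x=\sum_{i=1}^n(-1)^ia_i$ (so $x\ge0$). For $x\ge0$, $\mathrm{ev}(x)$ denotes the set of boards satisfying the displayed identities. -}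

module Defs where

open import Data.Nat using (ℕ; zero; suc; _≡ᵇ_; _*_) renaming (_+_ to _+ℕ_; _≤_ to _≤ℕ_)
open import Data.Fin using (Fin; toℕ; splitAt; punchIn)
open import Data.Bool using (Bool; true; false; _∨_)
open import Data.List using (List; []; _∷_; length; lookup; take)
open import Data.Sum using (_⊎_; inj₁; inj₂)
open import Data.Product using (Σ; ∃; ∃-syntax; _×_; _,_)
open import Relation.Binary.PropositionalEquality using (_≡_)
open import Algebra.Structures using (IsAbelianGroup)
open import Relation.Binary.Structures using (IsTotalOrder)

Even : ℕ → Set
Even n = ∃[ m ] n ≡ m +ℕ m

Odd : ℕ → Set
Odd n = ∃[ m ] n ≡ suc (m +ℕ m)

-- Weights: a totally ordered abelian group (the reals are an instance;
-- the standard library has no real numbers).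
record OrdAbGroup : Set₁ where
  infixl 6 _+_
  infix 4 _≤_
  field
    Carrier        : Set
    _≤_            : Carrier → Carrier → Set
    _+_            : Carrier → Carrier → Carrier
    0#             : Carrier
    -_             : Carrier → Carrier
    isAbelianGroup : IsAbelianGroup _≡_ _+_ 0# -_
    isTotalOrder   : IsTotalOrder _≡_ _≤_
    +-monoˡ-≤      : ∀ {a b} c → a ≤ b → a + c ≤ b + c

module Game (𝔾 : OrdAbGroup) where
  open OrdAbGroup 𝔾 public

  infixl 6 _-_
  _-_ : Carrier → Carrier → Carrier
  a - b = a + (- b)

  record Board (n : ℕ) : Set where
    field
      adj   : Fin n → Fin n → Bool
      wt    : Fin n → Carrier
      avail : Fin n → Bool

  open Board public

  IsSimple : ∀ {n} → Board n → Set
  IsSimple g = (∀ u v → adj g u v ≡ adj g v u) × (∀ v → adj g v v ≡ false)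

  data Reach {n} (g : Board n) (u : Fin n) : Fin n → Set where
    here : Reach g u u
    step : ∀ {w z} → Reach g u w → adj g w z ≡ true → Reach g u z

  -- legal moves: available vertices, and all vertices of unbroached components
  Legal : ∀ {n} → Board n → Fin n → Set
  Legal g v = (avail g v ≡ true) ⊎ (∀ w → Reach g v w → avail g w ≡ false)

  delete : ∀ {n} → Board (suc n) → Fin (suc n) → Board n
  delete g v = record
    { adj   = λ i j → adj g (punchIn v i) (punchIn v j)
    ; wt    = λ i → wt g (punchIn v i)
    ; avail = λ i → avail g (punchIn v i) ∨ adj g v (punchIn v i)
    }

  -- IsVal g x : x = val(g), the outcome for the player to move under optimal play.
  IsVal : ∀ {n} → Board n → Carrier → Set
  IsVal {zero}  g x = x ≡ 0#
  IsVal {suc n} g x =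
    (∃[ v ] (Legal g v × ∃[ y ] (IsVal (delete g v) y × x ≡ wt g v - y)))
    × (∀ v y → Legal g v → IsVal (delete g v) y → wt g v - y ≤ x)

  private
    adj⊕ : ∀ {m n} → (Fin m → Fin m → Bool) → (Fin n → Fin n → Bool)
         → Fin m ⊎ Fin n → Fin m ⊎ Fin n → Bool
    adj⊕ a b (inj₁ i) (inj₁ j) = a i j
    adj⊕ a b (inj₂ i) (inj₂ j) = b i j
    adj⊕ a b (inj₁ i) (inj₂ j) = false
    adj⊕ a b (inj₂ i) (inj₁ j) = false

    case⊕ : ∀ {m n} {A : Set} → (Fin m → A) → (Fin n → A) → Fin m ⊎ Fin n → A
    case⊕ f g (inj₁ i) = f i
    case⊕ f g (inj₂ i) = g i

  infixr 5 _⊕_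
  _⊕_ : ∀ {m n} → Board m → Board n → Board (m +ℕ n)
  _⊕_ {m} g h = record
    { adj   = λ i j → adj⊕ (adj g) (adj h) (splitAt m i) (splitAt m j)
    ; wt    = λ i → case⊕ (wt g) (wt h) (splitAt m i)
    ; avail = λ i → case⊕ (avail g) (avail h) (splitAt m i)
    }

  -- st(a₁,…,aₙ): path v₁…vₙ, wt vᵢ = aᵢ, available set {v₁}
  st : (as : List Carrier) → Board (length as)
  st as = record
    { adj   = λ i j → (suc (toℕ i) ≡ᵇ toℕ j) ∨ (suc (toℕ j) ≡ᵇ toℕ i)
    ; wt    = λ i → lookup as i
    ; avail = λ i → toℕ i ≡ᵇ 0
    }

  altSum : List Carrier → Carrier
  altSum []       = 0#
  altSum (a ∷ as) = a - altSum as

  IsEvSeq : List Carrier → Set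
  IsEvSeq as = Even (length as)
             × (∀ k → 1 ≤ℕ k → 2 * k ≤ℕ length as → altSum (take (2 * k) as) ≤ 0#)

  weight : List Carrier → Carrier
  weight as = - altSum as

module Submission where

-- Write s = altSum as, so that x = - s, and let y = val(h), z = val(st as ⊕ h).
-- On st as ⊕ h a move is either the head of the stalk (the only legal stalk
-- vertex) or a legal move of h; in the first case the position becomes
-- st (tail as) ⊕ h, in the second st as ⊕ (h \ u).
-- For a paired list (even length) two mutual inductions then give
--   even-upper : z ≤ y + s  (h even),   odd-lower : y - s ≤ z  (h odd),
-- and, when every even prefix has alternating sum ≤ d for some d ≥ 0,
--   even-lower : y + s ≤ z + 2d  (h even),   odd-upper : z ≤ (y - s) + 2d  (h odd).
-- With d = 0 these pin z down.

open import Defs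
open import Data.List using (List; []; _∷_; length; take)
open import Data.Nat using (ℕ)
open import Data.Product using (_×_)
open import Relation.Binary.PropositionalEquality using (_≡_)

open import Data.Nat as ℕ using (zero; suc)
import Data.Nat.Properties as ℕ
open import Data.Product using (∃; ∃-syntax; _,_; proj₁; proj₂)
open import Data.Sum as Sum using (_⊎_; inj₁; inj₂)
open import Data.Sum.Properties using (swap-involutive)
open import Data.Bool as Bool using (Bool; true; false; _∨_)
open import Data.Bool.Properties using (∨-identityʳ; ¬-not)
open import Data.Empty using (⊥; ⊥-elim)
open import Data.Fin as Fin using (Fin; zero; suc; punchIn; punchOut; splitAt; join; _↑ˡ_; _↑ʳ_)
open import Data.Fin.Properties
  using (splitAt-↑ˡ; splitAt-↑ʳ; splitAt⁻¹-↑ˡ; splitAt⁻¹-↑ʳ; splitAt-join; join-splitAt; punchIn-punchOut; any?)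
open import Data.Fin.Permutation
  using (Permutation; permutation; _⟨$⟩ʳ_; _⟨$⟩ˡ_; inverseˡ; inverseʳ; flip; _∘ₚ_; remove; punchIn-permute)
import Data.Fin.Permutation as Permutation
open import Data.Vec using ([]; _∷_)
open import Relation.Binary.PropositionalEquality using (refl; sym; trans; cong; cong₂; subst; subst₂; module ≡-Reasoning)
open import Relation.Nullary using (¬_; Dec; yes; no)
open import Relation.Nullary.Decidable using (_×-dec_)
open import Relation.Binary.Bundles using (Poset)
open import Relation.Binary.Structures using (IsTotalOrder)
import Relation.Binary.Reasoning.PartialOrder
open import Algebra.Bundles using (AbelianGroup)
open import Level using (0ℓ)

module EvStalk (𝔾 : OrdAbGroup) where
  open Game 𝔾

  open IsTotalOrder isTotalOrder using (total)
    renaming (refl to ≤-refl; trans to ≤-trans; antisym to ≤-antisym; reflexive to ≤-reflexive)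

  abelianGroup : AbelianGroup 0ℓ 0ℓ
  abelianGroup = record { isAbelianGroup = isAbelianGroup }

  poset : Poset 0ℓ 0ℓ 0ℓ
  poset = record { isPartialOrder = IsTotalOrder.isPartialOrder isTotalOrder }

  module ≤-Reasoning = Relation.Binary.Reasoning.PartialOrder poset

  open AbelianGroup abelianGroup using (commutativeMonoid; commutativeSemigroup)
    renaming (assoc to +-assoc; comm to +-comm; identityˡ to +-identityˡ;
              identityʳ to +-identityʳ; inverseˡ to -‿inverseˡ; inverseʳ to -‿inverseʳ)
  open import Algebra.Properties.AbelianGroup abelianGroup using (⁻¹-involutive; ⁻¹-∙-comm)
  open import Algebra.Properties.CommutativeSemigroup commutativeSemigroup using (x∙yz≈y∙xz)
  open import Algebra.Solver.CommutativeMonoid commutativeMonoid using (Expr; prove; var) renaming (_⊕_ to _⊞_)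

  +-monoʳ-≤ : ∀ {a b} c → a ≤ b → c + a ≤ c + b
  +-monoʳ-≤ {a} {b} c a≤b = subst₂ _≤_ (+-comm a c) (+-comm b c) (+-monoˡ-≤ c a≤b)

  +-inverse-cancelˡ : ∀ x y → x + (- x + y) ≡ y
  +-inverse-cancelˡ x y = trans (sym (+-assoc x (- x) y)) (trans (cong (_+ y) (-‿inverseʳ x)) (+-identityˡ y))

  -‿antitone : ∀ {a b} → a ≤ b → - b ≤ - a
  -‿antitone {a} {b} a≤b = subst₂ _≤_ (+-inverse-cancelˡ a (- b))
    (trans (cong (b +_) (+-comm (- a) (- b))) (+-inverse-cancelˡ b (- a)))
    (+-monoˡ-≤ (- a + - b) a≤b)

  -‿monoʳ-≤ : ∀ {a b} c → a ≤ b → c - b ≤ c - a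
  -‿monoʳ-≤ c a≤b = +-monoʳ-≤ c (-‿antitone a≤b)

  +-sub-cancelˡ : ∀ c t → (c + t) - c ≡ t
  +-sub-cancelˡ c t = begin
      (c + t) - c   ≡⟨ cong (_- c) (+-comm c t) ⟩
      (t + c) - c   ≡⟨ +-assoc t c (- c) ⟩
      t + (c - c)   ≡⟨ cong (t +_) (-‿inverseʳ c) ⟩
      t + 0#        ≡⟨ +-identityʳ t ⟩
      t             ∎
    where open ≡-Reasoning

  shiftˡ : ∀ {c t d} → c + t ≤ d → t ≤ d - c
  shiftˡ {c} {t} {d} c+t≤d = subst (_≤ d - c) (+-sub-cancelˡ c t) (+-monoˡ-≤ (- c) c+t≤d)

  0≤-of-≤ : ∀ {c d} → c ≤ d → 0# ≤ d - c
  0≤-of-≤ {c} {d} c≤d = shiftˡ (subst (_≤ d) (sym (+-identityʳ c)) c≤d)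

  0≤-double : ∀ {d} → 0# ≤ d → 0# ≤ d + d
  0≤-double {d} 0≤d = begin
      0#        ≡⟨ +-identityʳ 0# ⟨
      0# + 0#   ≤⟨ +-monoˡ-≤ 0# 0≤d ⟩
      d + 0#    ≤⟨ +-monoʳ-≤ d 0≤d ⟩
      d + d     ∎
    where open ≤-Reasoning

  -‿+-distrib : ∀ a b → - (a + b) ≡ - a - b
  -‿+-distrib a b = sym (⁻¹-∙-comm a b)

  sub-sub : ∀ a b c → a - (b - c) ≡ (a - b) + c
  sub-sub a b c = begin
      a + - (b + - c)     ≡⟨ cong (a +_) (-‿+-distrib b (- c)) ⟩
      a + (- b + - - c)   ≡⟨ cong (λ t → a + (- b + t)) (⁻¹-involutive c) ⟩
      a + (- b + c)       ≡⟨ +-assoc a (- b) c ⟨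
      (a - b) + c         ∎
    where open ≡-Reasoning

  sub-+ : ∀ a b c → (a - b) - c ≡ a - (b + c)
  sub-+ a b c = trans (+-assoc a (- b) (- c)) (cong (a +_) (sym (-‿+-distrib b c)))

  sub-+-cancel : ∀ a x e → (a - (x + e)) + e ≡ a - x
  sub-+-cancel a x e = begin
      (a - (x + e)) + e     ≡⟨ cong (_+ e) (sub-+ a x e) ⟨
      ((a - x) - e) + e     ≡⟨ +-assoc (a - x) (- e) e ⟩
      (a - x) + (- e + e)   ≡⟨ cong ((a - x) +_) (-‿inverseˡ e) ⟩
      (a - x) + 0#          ≡⟨ +-identityʳ (a - x) ⟩
      a - x                 ∎
    where open ≡-Reasoning

  -- Paying c out of the slack d: used when a pair (b₁, b₂) with b₁ - b₂ = c
  -- is taken off the stalk and the remaining prefixes are bounded by d - c.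
  slack-shift : ∀ c y s d → c + ((y - s) + ((d - c) + (d - c))) ≡ (y - (c + s)) + (d + d)
  slack-shift c y s d = begin
      c + ((y + - s) + ((d + - c) + (d + - c)))
        ≡⟨ prove 5 (C ⊞ ((Y ⊞ S) ⊞ ((D ⊞ N) ⊞ (D ⊞ N)))) ((C ⊞ N) ⊞ ((Y ⊞ (N ⊞ S)) ⊞ (D ⊞ D)))
                 (c ∷ y ∷ - s ∷ d ∷ - c ∷ []) ⟩
      (c + - c) + ((y + (- c + - s)) + (d + d))
        ≡⟨ cong (_+ ((y + (- c + - s)) + (d + d))) (-‿inverseʳ c) ⟩
      0# + ((y + (- c + - s)) + (d + d))
        ≡⟨ +-identityˡ _ ⟩
      (y + (- c + - s)) + (d + d)
        ≡⟨ cong (λ t → (y + t) + (d + d)) (-‿+-distrib c s) ⟨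
      (y - (c + s)) + (d + d) ∎
    where
    open ≡-Reasoning
    C Y S D N : Expr 5
    C = var zero
    Y = var (suc zero)
    S = var (suc (suc zero))
    D = var (suc (suc (suc zero)))
    N = var (suc (suc (suc (suc zero))))

  even-pred : ∀ {m} → Even (suc m) → Odd m
  even-pred (zero , ())
  even-pred (suc k , eq) = k , trans (ℕ.suc-injective eq) (ℕ.+-suc k k)

  odd-pred : ∀ {m} → Odd (suc m) → Even m
  odd-pred (k , eq) = k , ℕ.suc-injective eq

  ¬odd-zero : ¬ Odd 0
  ¬odd-zero (k , ())

  true≢false : true ≡ false → ⊥
  true≢false ()

  -- Values are unique: two optimal outcomes bound each other.
  val-unique : ∀ {N} {g : Board N} {x x'} → IsVal g x → IsVal g x' → x ≡ x'
  val-unique {zero} p q = trans p (sym q)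
  val-unique {suc N} ((v , L , y , V , refl) , M) ((v' , L' , y' , V' , refl) , M') =
    ≤-antisym (M' v y L V) (M v' y' L' V')

  Broached : ∀ {N} → Board N → Fin N → Set
  Broached g v = ∃[ w ] Reach g v w × avail g w ≡ true

  erase : ∀ {N} → Board (suc N) → Fin (suc N) → Board N
  erase g v = record
    { adj   = λ i j → adj g (punchIn v i) (punchIn v j)
    ; wt    = λ i → wt g (punchIn v i)
    ; avail = λ i → avail g (punchIn v i)
    }

  reach-cons : ∀ {N} {g : Board N} {a b c} → adj g a b ≡ true → Reach g b c → Reach g a c
  reach-cons e here       = step here e
  reach-cons e (step r f) = step (reach-cons e r) f

  reach-erase : ∀ {N} {g : Board (suc N)} {v a b} → Reach (erase g v) a b → Reach g (punchIn v a) (punchIn v b)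
  reach-erase here       = here
  reach-erase (step r e) = step (reach-erase r) e

  data Departure {N} (g : Board (suc N)) (v : Fin (suc N)) : Fin (suc N) → Set where
    stay  : Departure g v v
    leave : ∀ z w → adj g v (punchIn v z) ≡ true → Reach (erase g v) z w → Departure g v (punchIn v w)

  depart-step : ∀ {N} {g : Board (suc N)} {v w j} → Departure g v w → adj g w (punchIn v j) ≡ true →
                Departure g v (punchIn v j)
  depart-step stay             e = leave _ _ e here
  depart-step (leave z w e₀ r) e = leave z _ e₀ (step r e)

  reach-from : ∀ {N} {g : Board (suc N)} {v w} → Reach g v w → Departure g v w
  reach-from here = stay
  reach-from {g = g} {v} (step {w} {z} r e) with z Fin.≟ v
  ... | yes refl = stay
  ... | no z≢v = subst (Departure g v) (punchIn-punchOut v≢z)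
                   (depart-step (reach-from r) (subst (λ t → adj g w t ≡ true) (sym (punchIn-punchOut v≢z)) e))
    where
    v≢z : v ≡ z → ⊥
    v≢z q = z≢v (sym q)

  -- Broachedness is decidable: look for a neighbour broached in erase g v.
  broached? : ∀ {N} (g : Board N) v → Dec (Broached g v)
  broached? {suc N} g v with avail g v in av
  ... | true = yes (v , here , av)
  ... | false with any? (λ z → (adj g v (punchIn v z) Bool.≟ true) ×-dec broached? (erase g v) z)
  ...   | yes (z , e , w , r , a) = yes (punchIn v w , reach-cons e (reach-erase r) , a)
  ...   | no none = no (λ (w , r , a) → unreachable (reach-from r) a)
    where
    unreachable : ∀ {w} → Departure g v w → avail g w ≡ true → ⊥
    unreachable stay            a = true≢false (trans (sym a) av)
    unreachable (leave z w e r) a = none (z , e , w , r , a)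

  legal? : ∀ {N} (g : Board N) v → Dec (Legal g v)
  legal? g v with avail g v
  ... | true = yes (inj₁ refl)
  ... | false with broached? g v
  ...   | yes (w , r , a) = no λ { (inj₁ ())
                                 ; (inj₂ f) → true≢false (trans (sym a) (f w r)) }
  ...   | no unbroached = yes (inj₂ λ w r → ¬-not λ a → unbroached (w , r , a))

  -- A nonempty board has a legal move: an available vertex, or else any vertex.
  legal-exists : ∀ {N} (g : Board (suc N)) → ∃ (Legal g)
  legal-exists g with broached? g zero
  ... | yes (w , r , a)  = w , inj₁ a
  ... | no unbroached    = zero , inj₂ λ w r → ¬-not λ a → unbroached (w , r , a)

  argmax : ∀ {k} (Q : Fin k → Set) → (∀ v → Dec (Q v)) → (f : Fin k → Carrier) → ∃ Q →
           ∃[ v ] (Q v × (∀ u → Q u → f u ≤ f v))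
  argmax {suc k} Q Q? f (v₀ , q₀) with any? (λ i → Q? (suc i))
  ... | no none = zero , at-zero v₀ q₀ , λ { zero _ → ≤-refl ; (suc u) q → ⊥-elim (none (u , q)) }
    where
    at-zero : ∀ v → Q v → Q zero
    at-zero zero    q = q
    at-zero (suc u) q = ⊥-elim (none (u , q))
  ... | yes some with argmax (λ i → Q (suc i)) (λ i → Q? (suc i)) (λ i → f (suc i)) some
  ...   | v , q , best with Q? zero
  ...     | no ¬q₀ = suc v , q , λ { zero q′ → ⊥-elim (¬q₀ q′) ; (suc u) q′ → best u q′ }
  ...     | yes q₀′ with total (f zero) (f (suc v))
  ...       | inj₁ f0≤ = suc v , q , λ { zero _ → f0≤ ; (suc u) q′ → best u q′ }
  ...       | inj₂ ≤f0 = zero , q₀′ , λ { zero _ → ≤-refl ; (suc u) q′ → ≤-trans (best u q′) ≤f0 }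

  -- If every g \ v has a value then so has g: play a legal move maximising
  -- wt v - val (g \ v).
  val-step : ∀ {N} (g : Board (suc N)) → (∀ v → ∃ (IsVal (delete g v))) → ∃ (IsVal g)
  val-step g sub with argmax (Legal g) (legal? g) (λ v → wt g v - proj₁ (sub v)) (legal-exists g)
  ... | v , legal , best =
    wt g v - proj₁ (sub v) ,
    (v , legal , proj₁ (sub v) , proj₂ (sub v) , refl) ,
    λ u y L V → subst (λ t → wt g u - t ≤ wt g v - proj₁ (sub v)) (val-unique (proj₂ (sub u)) V) (best u L)

  val-exists : ∀ {N} (g : Board N) → ∃ (IsVal g)
  val-exists {zero}  g = 0# , refl
  val-exists {suc N} g = val-step g (λ v → val-exists (delete g v))

  value-is : ∀ {N} (g : Board N) {t} → (∀ {z} → IsVal g z → z ≡ t) →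
             IsVal g t × (∀ z → IsVal g z → z ≡ t)
  value-is g pin with val-exists g
  ... | z , val = subst (IsVal g) (pin val) val , λ _ val′ → pin val′

  infix 4 _≅_
  record _≅_ {N N′} (g : Board N) (g′ : Board N′) : Set where
    field
      π      : Permutation N N′
      adj≡   : ∀ i j → adj g′ (π ⟨$⟩ʳ i) (π ⟨$⟩ʳ j) ≡ adj g i j
      wt≡    : ∀ i → wt g′ (π ⟨$⟩ʳ i) ≡ wt g i
      avail≡ : ∀ i → avail g′ (π ⟨$⟩ʳ i) ≡ avail g i
  open _≅_

  ≅-pointwise : ∀ {N} {g g′ : Board N} → (∀ i j → adj g′ i j ≡ adj g i j) → (∀ i → wt g′ i ≡ wt g i) →
                (∀ i → avail g′ i ≡ avail g i) → g ≅ g′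
  ≅-pointwise a w v = record { π = Permutation.id ; adj≡ = a ; wt≡ = w ; avail≡ = v }

  ≅-sym : ∀ {N N′} {g : Board N} {g′ : Board N′} → g ≅ g′ → g′ ≅ g
  ≅-sym {g = g} {g′} I = record
    { π      = flip (π I)
    ; adj≡   = λ a b → sym (trans (cong₂ (adj g′) (sym (inverseʳ (π I))) (sym (inverseʳ (π I)))) (adj≡ I _ _))
    ; wt≡    = λ a → sym (trans (cong (wt g′) (sym (inverseʳ (π I)))) (wt≡ I _))
    ; avail≡ = λ a → sym (trans (cong (avail g′) (sym (inverseʳ (π I)))) (avail≡ I _))
    }

  ≅-trans : ∀ {N N′ N″} {g : Board N} {g′ : Board N′} {g″ : Board N″} → g ≅ g′ → g′ ≅ g″ → g ≅ g″
  ≅-trans I J = record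
    { π      = π I ∘ₚ π J
    ; adj≡   = λ a b → trans (adj≡ J _ _) (adj≡ I a b)
    ; wt≡    = λ a → trans (wt≡ J _) (wt≡ I a)
    ; avail≡ = λ a → trans (avail≡ J _) (avail≡ I a)
    }

  ≅-delete : ∀ {N N′} {g : Board (suc N)} {g′ : Board (suc N′)} (I : g ≅ g′) (v : Fin (suc N)) →
             delete g v ≅ delete g′ (π I ⟨$⟩ʳ v)
  ≅-delete {g = g} {g′} I v = record
    { π      = remove v (π I)
    ; adj≡   = λ i j → trans (cong₂ (adj g′) (sym (permute i)) (sym (permute j))) (adj≡ I _ _)
    ; wt≡    = λ i → trans (cong (wt g′) (sym (permute i))) (wt≡ I _)
    ; avail≡ = λ i → trans (cong (λ t → avail g′ t ∨ adj g′ (π I ⟨$⟩ʳ v) t) (sym (permute i)))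
                           (cong₂ _∨_ (avail≡ I _) (adj≡ I _ _))
    }
    where
    permute : ∀ i → π I ⟨$⟩ʳ punchIn v i ≡ punchIn (π I ⟨$⟩ʳ v) (remove v (π I) ⟨$⟩ʳ i)
    permute i = punchIn-permute (π I) v i

  ≅-reach : ∀ {N N′} {g : Board N} {g′ : Board N′} (I : g ≅ g′) {a b} → Reach g a b → Reach g′ (π I ⟨$⟩ʳ a) (π I ⟨$⟩ʳ b)
  ≅-reach I here       = here
  ≅-reach I (step r e) = step (≅-reach I r) (trans (adj≡ I _ _) e)

  ≅-legal : ∀ {N N′} {g : Board N} {g′ : Board N′} (I : g ≅ g′) {v} → Legal g v → Legal g′ (π I ⟨$⟩ʳ v)
  ≅-legal I (inj₁ e) = inj₁ (trans (avail≡ I _) e)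
  ≅-legal {g = g} I (inj₂ f) = inj₂ λ w r →
    let r′ = subst (λ t → Reach g t (π (≅-sym I) ⟨$⟩ʳ w)) (inverseˡ (π I)) (≅-reach (≅-sym I) r)
    in trans (sym (avail≡ (≅-sym I) w)) (f _ r′)

  ≅-val : ∀ {N N′} {g : Board N} {g′ : Board N′} → g ≅ g′ → ∀ {x} → IsVal g x → IsVal g′ x
  ≅-val {zero}  {zero}   I p = p
  ≅-val {zero}  {suc N′} I p with π I ⟨$⟩ˡ zero
  ... | ()
  ≅-val {suc N} {zero}   I p with π I ⟨$⟩ʳ zero
  ... | ()
  ≅-val {suc N} {suc N′} {g} {g′} I {x} ((v , L , y , V , e) , M) =
    (π I ⟨$⟩ʳ v , ≅-legal I L , y , ≅-val (≅-delete I v) V , trans e (cong (_- y) (sym (wt≡ I v)))) ,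
    λ v′ y′ L′ V′ → subst (λ t → t - y′ ≤ x) (wt≡ (≅-sym I) v′)
                      (M _ y′ (≅-legal (≅-sym I) L′) (≅-val (≅-delete (≅-sym I) v′) V′))

  -- Disjoint unions.  The constructions of _⊕_ in Defs are private, so the
  -- same case analysis on splitAt is restated here.
  adj-sum : ∀ {m n} → (Fin m → Fin m → Bool) → (Fin n → Fin n → Bool) → Fin m ⊎ Fin n → Fin m ⊎ Fin n → Bool
  adj-sum a b (inj₁ i) (inj₁ j) = a i j
  adj-sum a b (inj₂ i) (inj₂ j) = b i j
  adj-sum a b (inj₁ i) (inj₂ j) = false
  adj-sum a b (inj₂ i) (inj₁ j) = false

  case-sum : ∀ {m n} {A : Set} → (Fin m → A) → (Fin n → A) → Fin m ⊎ Fin n → A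
  case-sum f g (inj₁ i) = f i
  case-sum f g (inj₂ i) = g i

  adj-⊕ : ∀ {m n} (g : Board m) (k : Board n) a b → adj (g ⊕ k) a b ≡ adj-sum (adj g) (adj k) (splitAt m a) (splitAt m b)
  adj-⊕ {m} g k a b with splitAt m a | splitAt m b
  ... | inj₁ x | inj₁ y = refl
  ... | inj₁ x | inj₂ y = refl
  ... | inj₂ x | inj₁ y = refl
  ... | inj₂ x | inj₂ y = refl

  wt-⊕ : ∀ {m n} (g : Board m) (k : Board n) a → wt (g ⊕ k) a ≡ case-sum (wt g) (wt k) (splitAt m a)
  wt-⊕ {m} g k a with splitAt m a
  ... | inj₁ x = refl
  ... | inj₂ x = refl

  avail-⊕ : ∀ {m n} (g : Board m) (k : Board n) a → avail (g ⊕ k) a ≡ case-sum (avail g) (avail k) (splitAt m a)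
  avail-⊕ {m} g k a with splitAt m a
  ... | inj₁ x = refl
  ... | inj₂ x = refl

  reach-↑ˡ : ∀ {m n} {g : Board m} {k : Board n} {a b} → Reach g a b → Reach (g ⊕ k) (a ↑ˡ n) (b ↑ˡ n)
  reach-↑ˡ here = here
  reach-↑ˡ {m} {n} {g} {k} (step {w} {z} r e) = step (reach-↑ˡ r)
    (trans (adj-⊕ g k _ _) (subst₂ (λ s t → adj-sum (adj g) (adj k) s t ≡ true) (sym (splitAt-↑ˡ m w n)) (sym (splitAt-↑ˡ m z n)) e))

  reach-↑ʳ : ∀ {m n} {g : Board m} {k : Board n} {a b} → Reach k a b → Reach (g ⊕ k) (m ↑ʳ a) (m ↑ʳ b)
  reach-↑ʳ here = here
  reach-↑ʳ {m} {n} {g} {k} (step {w} {z} r e) = step (reach-↑ʳ r)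
    (trans (adj-⊕ g k _ _) (subst₂ (λ s t → adj-sum (adj g) (adj k) s t ≡ true) (sym (splitAt-↑ʳ m n w)) (sym (splitAt-↑ʳ m n z)) e))

  step-within-right : ∀ {m n} {A : Fin m → Fin m → Bool} {B : Fin n → Fin n → Bool} {i} (s : Fin m ⊎ Fin n) →
                      adj-sum A B (inj₂ i) s ≡ true → ∃[ x ] (s ≡ inj₂ x × B i x ≡ true)
  step-within-right (inj₁ x) ()
  step-within-right (inj₂ x) e = x , refl , e

  reach-within-right : ∀ {m n} {g : Board m} {k : Board n} {v w i} → Reach (g ⊕ k) v w → splitAt m v ≡ inj₂ i →
                       ∃[ i′ ] (splitAt m w ≡ inj₂ i′ × Reach k i i′)
  reach-within-right {i = i} here eq = i , eq , here
  reach-within-right {m} {n} {g} {k} (step {w} {z} r e) eq with reach-within-right r eq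
  ... | i′ , eqw , R
    with step-within-right (splitAt m z) (subst (λ s → adj-sum (adj g) (adj k) s (splitAt m z) ≡ true) eqw (trans (sym (adj-⊕ g k w z)) e))
  ...   | x , eqz , e′ = x , eqz , step R e′

  legal-↑ʳ : ∀ {m n} {g : Board m} {k : Board n} {u} → Legal k u → Legal (g ⊕ k) (m ↑ʳ u)
  legal-↑ʳ {m} {n} {g} {k} {u} (inj₁ e) =
    inj₁ (trans (avail-⊕ g k _) (subst (λ s → case-sum (avail g) (avail k) s ≡ true) (sym (splitAt-↑ʳ m n u)) e))
  legal-↑ʳ {m} {n} {g} {k} {u} (inj₂ f) = inj₂ λ w r →
    let (u′ , eqw , R) = reach-within-right r (splitAt-↑ʳ m n u)
    in trans (avail-⊕ g k w) (subst (λ s → case-sum (avail g) (avail k) s ≡ false) (sym eqw) (f u′ R))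

  legal-left⁻ : ∀ {m n} {g : Board m} {k : Board n} {v i} → Legal (g ⊕ k) v → splitAt m v ≡ inj₁ i → Legal g i
  legal-left⁻ {m} {n} {g} {k} {v} (inj₁ e) eq =
    inj₁ (trans (sym (cong (case-sum (avail g) (avail k)) eq)) (trans (sym (avail-⊕ g k v)) e))
  legal-left⁻ {m} {n} {g} {k} {v} {i} (inj₂ f) eq = inj₂ λ i′ R →
    let r = subst (λ t → Reach (g ⊕ k) t (i′ ↑ˡ n)) (splitAt⁻¹-↑ˡ eq) (reach-↑ˡ R)
    in trans (sym (cong (case-sum (avail g) (avail k)) (splitAt-↑ˡ m i′ n))) (trans (sym (avail-⊕ g k _)) (f _ r))

  legal-right⁻ : ∀ {m n} {g : Board m} {k : Board n} {v i} → Legal (g ⊕ k) v → splitAt m v ≡ inj₂ i → Legal k i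
  legal-right⁻ {m} {n} {g} {k} {v} (inj₁ e) eq =
    inj₁ (trans (sym (cong (case-sum (avail g) (avail k)) eq)) (trans (sym (avail-⊕ g k v)) e))
  legal-right⁻ {m} {n} {g} {k} {v} {i} (inj₂ f) eq = inj₂ λ i′ R →
    let r = subst (λ t → Reach (g ⊕ k) t (m ↑ʳ i′)) (splitAt⁻¹-↑ʳ eq) (reach-↑ʳ R)
    in trans (sym (cong (case-sum (avail g) (avail k)) (splitAt-↑ʳ m n i′))) (trans (sym (avail-⊕ g k _)) (f _ r))

  wt-right : ∀ {m n} (g : Board m) (k : Board n) {v u} → splitAt m v ≡ inj₂ u → wt (g ⊕ k) v ≡ wt k u
  wt-right g k {v} eq = trans (wt-⊕ g k v) (cong (case-sum (wt g) (wt k)) eq)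

  splitAt-punchIn : ∀ {m n} (i : Fin (suc m)) (j : Fin (m ℕ.+ n)) →
                    splitAt (suc m) (punchIn (i ↑ˡ n) j) ≡ Sum.map₁ (punchIn i) (splitAt m j)
  splitAt-punchIn zero j = refl
  splitAt-punchIn {suc m} (suc i) zero = refl
  splitAt-punchIn {suc m} {n} (suc i) (suc j) rewrite splitAt-punchIn {m} {n} i j with splitAt m j
  ... | inj₁ x = refl
  ... | inj₂ x = refl

  adj-sum-map : ∀ {m m′ n} (A : Fin m′ → Fin m′ → Bool) (B : Fin n → Fin n → Bool) (f : Fin m → Fin m′) sa sb →
                adj-sum (λ x y → A (f x) (f y)) B sa sb ≡ adj-sum A B (Sum.map₁ f sa) (Sum.map₁ f sb)
  adj-sum-map A B f (inj₁ x) (inj₁ y) = refl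
  adj-sum-map A B f (inj₁ x) (inj₂ y) = refl
  adj-sum-map A B f (inj₂ x) (inj₁ y) = refl
  adj-sum-map A B f (inj₂ x) (inj₂ y) = refl

  case-sum-map : ∀ {m m′ n} {X : Set} (A : Fin m′ → X) (B : Fin n → X) (f : Fin m → Fin m′) sa →
                 case-sum (λ x → A (f x)) B sa ≡ case-sum A B (Sum.map₁ f sa)
  case-sum-map A B f (inj₁ x) = refl
  case-sum-map A B f (inj₂ x) = refl

  -- The new availability after deleting i: only neighbours of i in g gain it.
  avail-sum-map : ∀ {m n} (g : Board (suc m)) (k : Board n) (i : Fin (suc m)) sa →
                  case-sum (λ x → avail g (punchIn i x) ∨ adj g i (punchIn i x)) (avail k) sa
                  ≡ (case-sum (avail g) (avail k) (Sum.map₁ (punchIn i) sa) ∨ adj-sum (adj g) (adj k) (inj₁ i) (Sum.map₁ (punchIn i) sa))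
  avail-sum-map g k i (inj₁ x) = refl
  avail-sum-map g k i (inj₂ x) = sym (∨-identityʳ _)

  delete-left : ∀ {m n} (g : Board (suc m)) (k : Board n) i → delete (g ⊕ k) (i ↑ˡ n) ≅ delete g i ⊕ k
  delete-left {m} {n} g k i = ≅-pointwise A W V
    where
    A : ∀ a b → adj (delete g i ⊕ k) a b ≡ adj (delete (g ⊕ k) (i ↑ˡ n)) a b
    A a b = trans (adj-⊕ (delete g i) k a b) (trans (adj-sum-map (adj g) (adj k) (punchIn i) (splitAt m a) (splitAt m b))
              (sym (trans (adj-⊕ g k (punchIn (i ↑ˡ n) a) (punchIn (i ↑ˡ n) b))
                          (cong₂ (adj-sum (adj g) (adj k)) (splitAt-punchIn i a) (splitAt-punchIn i b)))))
    W : ∀ a → wt (delete g i ⊕ k) a ≡ wt (delete (g ⊕ k) (i ↑ˡ n)) a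
    W a = trans (wt-⊕ (delete g i) k a) (trans (case-sum-map (wt g) (wt k) (punchIn i) (splitAt m a))
              (sym (trans (wt-⊕ g k (punchIn (i ↑ˡ n) a)) (cong (case-sum (wt g) (wt k)) (splitAt-punchIn i a)))))
    V : ∀ a → avail (delete g i ⊕ k) a ≡ avail (delete (g ⊕ k) (i ↑ˡ n)) a
    V a = trans (avail-⊕ (delete g i) k a) (trans (avail-sum-map g k i (splitAt m a))
              (sym (cong₂ _∨_ (trans (avail-⊕ g k (punchIn (i ↑ˡ n) a)) (cong (case-sum (avail g) (avail k)) (splitAt-punchIn i a)))
                              (trans (adj-⊕ g k (i ↑ˡ n) (punchIn (i ↑ˡ n) a))
                                     (cong₂ (adj-sum (adj g) (adj k)) (splitAt-↑ˡ (suc m) i n) (splitAt-punchIn i a))))))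

  swap-perm : ∀ m n → Permutation (m ℕ.+ n) (n ℕ.+ m)
  swap-perm m n = permutation (λ a → join n m (Sum.swap (splitAt m a))) (λ b → join m n (Sum.swap (splitAt n b)))
                              (round-trip m n) (round-trip n m)
    where
    round-trip : ∀ p q y → join q p (Sum.swap (splitAt p (join p q (Sum.swap (splitAt q y))))) ≡ y
    round-trip p q y = trans (cong (λ s → join q p (Sum.swap s)) (splitAt-join p q (Sum.swap (splitAt q y))))
                             (trans (cong (join q p) (swap-involutive (splitAt q y))) (join-splitAt q p y))

  adj-sum-swap : ∀ {m n} (A : Fin m → Fin m → Bool) (B : Fin n → Fin n → Bool) sa sb →
                 adj-sum B A (Sum.swap sa) (Sum.swap sb) ≡ adj-sum A B sa sb
  adj-sum-swap A B (inj₁ x) (inj₁ y) = refl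
  adj-sum-swap A B (inj₁ x) (inj₂ y) = refl
  adj-sum-swap A B (inj₂ x) (inj₁ y) = refl
  adj-sum-swap A B (inj₂ x) (inj₂ y) = refl

  case-sum-swap : ∀ {m n} {X : Set} (A : Fin m → X) (B : Fin n → X) sa → case-sum B A (Sum.swap sa) ≡ case-sum A B sa
  case-sum-swap A B (inj₁ x) = refl
  case-sum-swap A B (inj₂ x) = refl

  ⊕-comm : ∀ {m n} (g : Board m) (k : Board n) → g ⊕ k ≅ k ⊕ g
  ⊕-comm {m} {n} g k = record
    { π      = swap-perm m n
    ; adj≡   = λ a b → trans (adj-⊕ k g _ _) (trans (cong₂ (adj-sum (adj k) (adj g)) (swapped a) (swapped b))
                         (trans (adj-sum-swap (adj g) (adj k) (splitAt m a) (splitAt m b)) (sym (adj-⊕ g k a b))))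
    ; wt≡    = λ a → trans (wt-⊕ k g _) (trans (cong (case-sum (wt k) (wt g)) (swapped a))
                         (trans (case-sum-swap (wt g) (wt k) (splitAt m a)) (sym (wt-⊕ g k a))))
    ; avail≡ = λ a → trans (avail-⊕ k g _) (trans (cong (case-sum (avail k) (avail g)) (swapped a))
                         (trans (case-sum-swap (avail g) (avail k) (splitAt m a)) (sym (avail-⊕ g k a))))
    }
    where
    swapped : ∀ a → splitAt n (swap-perm m n ⟨$⟩ʳ a) ≡ Sum.swap (splitAt m a)
    swapped a = splitAt-join n m (Sum.swap (splitAt m a))

  -- Deleting a vertex of the right summand, by commuting it to the left.
  delete-right : ∀ {l m} (g : Board (suc l)) (k : Board (suc m)) v u → splitAt (suc l) v ≡ inj₂ u →
                 delete (g ⊕ k) v ≅ g ⊕ delete k u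
  delete-right {l} {m} g k v u eq =
    ≅-trans (subst (λ t → delete (g ⊕ k) v ≅ delete (k ⊕ g) t) to-left (≅-delete (⊕-comm g k) v))
            (≅-trans (delete-left k g u) (⊕-comm (delete k u) g))
    where
    to-left : join (suc m) (suc l) (Sum.swap (splitAt (suc l) v)) ≡ u ↑ˡ suc l
    to-left = cong (λ s → join (suc m) (suc l) (Sum.swap s)) eq

  -- Stalks: every vertex reaches the head, which is the only available one,
  -- so the head is the only legal move; deleting it leaves the tail stalk.
  reach-suc : ∀ {b bs a c} → Reach (st bs) a c → Reach (st (b ∷ bs)) (suc a) (suc c)
  reach-suc here       = here
  reach-suc (step r e) = step (reach-suc r) e

  reach-head : ∀ {b bs} (i : Fin (suc (length bs))) → Reach (st (b ∷ bs)) i zero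
  reach-head zero = here
  reach-head {b} {c ∷ cs} (suc j) = step (reach-suc (reach-head {c} {cs} j)) refl

  stalk-legal⇒head : ∀ {b bs i} → Legal (st (b ∷ bs)) i → i ≡ zero
  stalk-legal⇒head {i = zero}  _        = refl
  stalk-legal⇒head {i = suc j} (inj₁ ())
  stalk-legal⇒head {i = suc j} (inj₂ f) with f zero (reach-head (suc j))
  ... | ()

  -- The new head of the stalk is available because it neighboured the old head.
  is-zero≡ : ∀ k → (k ℕ.≡ᵇ 0) ≡ ((0 ℕ.≡ᵇ k) ∨ false)
  is-zero≡ zero    = refl
  is-zero≡ (suc k) = refl

  delete-head : ∀ {b bs n} {h : Board n} → delete (st (b ∷ bs) ⊕ h) zero ≅ st bs ⊕ h
  delete-head {b} {bs} {n} {h} = ≅-pointwise A W V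
    where
    A : ∀ i j → adj (st bs ⊕ h) i j ≡ adj (delete (st (b ∷ bs) ⊕ h) zero) i j
    A i j with splitAt (length bs) i | splitAt (length bs) j
    ... | inj₁ x | inj₁ y = refl
    ... | inj₁ x | inj₂ y = refl
    ... | inj₂ x | inj₁ y = refl
    ... | inj₂ x | inj₂ y = refl
    W : ∀ i → wt (st bs ⊕ h) i ≡ wt (delete (st (b ∷ bs) ⊕ h) zero) i
    W i with splitAt (length bs) i
    ... | inj₁ x = refl
    ... | inj₂ x = refl
    V : ∀ i → avail (st bs ⊕ h) i ≡ avail (delete (st (b ∷ bs) ⊕ h) zero) i
    V i with splitAt (length bs) i
    ... | inj₁ x = is-zero≡ (Fin.toℕ x)
    ... | inj₂ x = sym (∨-identityʳ _)

  -- MoveOutcome bs h x: some legal first move on st bs ⊕ h, followed by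
  -- optimal play, yields x for the mover.  It is a move at the head of the
  -- stalk or a legal move u of h.
  data MoveOutcome : List Carrier → ∀ {n} → Board n → Carrier → Set where
    head-move : ∀ {b bs n} {h : Board n} {y} → IsVal (st bs ⊕ h) y → MoveOutcome (b ∷ bs) h (b - y)
    host-move : ∀ {bs m} {h : Board (suc m)} {u y} → Legal h u → IsVal (st bs ⊕ delete h u) y →
                MoveOutcome bs h (wt h u - y)

  move≤value : ∀ {bs n} {h : Board n} {x z} → MoveOutcome bs h x → IsVal (st bs ⊕ h) z → x ≤ z
  move≤value (head-move {b} {bs} {n} {h} val) (_ , best) =
    best zero _ (inj₁ refl) (≅-val (≅-sym (delete-head {b} {bs} {n} {h})) val)
  move≤value (host-move {[]} legal val) (_ , best) = best _ _ legal val
  move≤value (host-move {b ∷ bs} {m} {h} {u} {y} legal val) (_ , best) =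
    subst (λ t → t - y ≤ _) (wt-right (st (b ∷ bs)) h inside)
      (best v y (legal-↑ʳ legal) (≅-val (≅-sym (delete-right (st (b ∷ bs)) h v u inside)) val))
    where
    v : Fin (suc (length bs) ℕ.+ suc m)
    v = suc (length bs) ↑ʳ u
    inside : splitAt (suc (length bs)) v ≡ inj₂ u
    inside = splitAt-↑ʳ (suc (length bs)) (suc m) u

  classify : ∀ {b bs n} {h : Board n} {v y} → Legal (st (b ∷ bs) ⊕ h) v → IsVal (delete (st (b ∷ bs) ⊕ h) v) y →
             ∀ s → splitAt (suc (length bs)) v ≡ s → MoveOutcome (b ∷ bs) h (wt (st (b ∷ bs) ⊕ h) v - y)
  classify {b} {bs} {n} {h} {v} {y} legal val (inj₁ i) eq =
    at-head {b} {bs} {v} {y} {h} v≡head val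
    where
    v≡head : v ≡ zero
    v≡head = trans (sym (splitAt⁻¹-↑ˡ eq)) (cong (_↑ˡ n) (stalk-legal⇒head (legal-left⁻ {g = st (b ∷ bs)} {k = h} legal eq)))
    at-head : ∀ {b bs v y} {h : Board n} → v ≡ zero → IsVal (delete (st (b ∷ bs) ⊕ h) v) y →
              MoveOutcome (b ∷ bs) h (wt (st (b ∷ bs) ⊕ h) v - y)
    at-head {b} {bs} {h = h} refl val′ = head-move (≅-val (delete-head {b} {bs} {n} {h}) val′)
  classify {n = zero} legal val (inj₂ ()) eq
  classify {b} {bs} {suc m} {h} {v} {y} legal val (inj₂ u) eq =
    subst (λ t → MoveOutcome (b ∷ bs) h (t - y)) (sym (wt-right (st (b ∷ bs)) h {v} eq))
      (host-move (legal-right⁻ {g = st (b ∷ bs)} {k = h} legal eq) (≅-val (delete-right (st (b ∷ bs)) h v u eq) val))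

  optimal-move : ∀ bs {n} (h : Board n) {z} → IsVal (st bs ⊕ h) z →
                 MoveOutcome bs h z ⊎ (bs ≡ [] × n ≡ 0 × z ≡ 0#)
  optimal-move []       {zero}  h val = inj₂ (refl , refl , val)
  optimal-move []       {suc m} h ((u , legal , y , val , refl) , _) = inj₁ (host-move legal val)
  optimal-move (b ∷ bs) h ((v , legal , y , val , refl) , _) = inj₁ (classify legal val _ refl)

  -- A pure stalk is played from the head down, so its value is its
  -- alternating sum.
  stalk-value : ∀ bs {h : Board 0} {z} → IsVal (st bs ⊕ h) z → z ≡ altSum bs
  stalk-value []       val = val
  stalk-value (b ∷ bs) {h} val with optimal-move (b ∷ bs) h val
  ... | inj₁ (head-move val₁) = cong (λ t → b - t) (stalk-value bs val₁)
  ... | inj₂ (() , _)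

  data Paired : List Carrier → Set where
    done : Paired []
    pair : ∀ b₁ b₂ {bs} → Paired bs → Paired (b₁ ∷ b₂ ∷ bs)

  -- Bounded d bs: bs is paired and every even prefix has alternating sum ≤ d.
  data Bounded : Carrier → List Carrier → Set where
    done : ∀ {d} → Bounded d []
    pair : ∀ {d} b₁ b₂ {bs} → b₁ - b₂ ≤ d → Bounded (d - (b₁ - b₂)) bs → Bounded d (b₁ ∷ b₂ ∷ bs)

  paired : ∀ as m → length as ≡ m ℕ.+ m → Paired as
  paired []            m       _ = done
  paired (a ∷ [])      zero    ()
  paired (a ∷ [])      (suc m) eq with trans (ℕ.suc-injective eq) (ℕ.+-suc m m)
  ... | ()
  paired (a ∷ b ∷ as) zero    ()
  paired (a ∷ b ∷ as) (suc m) eq = pair a b (paired as m (ℕ.suc-injective (trans (ℕ.suc-injective eq) (ℕ.+-suc m m))))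

  PrefixBound : Carrier → List Carrier → Set
  PrefixBound d bs = ∀ k → 1 ℕ.≤ k → 2 ℕ.* k ℕ.≤ length bs → altSum (take (2 ℕ.* k) bs) ≤ d

  -- The first pair gives b₁ - b₂ ≤ d; the prefix of length 2(k+1) of
  -- b₁ ∷ b₂ ∷ bs has alternating sum (b₁ - b₂) + (prefix of length 2k of bs).
  bounded : ∀ {bs} → Paired bs → ∀ d → PrefixBound d bs → Bounded d bs
  bounded done d _ = done
  bounded (pair b₁ b₂ {bs} p) d prefix = pair b₁ b₂ first (bounded p (d - (b₁ - b₂)) rest)
    where
    first : b₁ - b₂ ≤ d
    first = subst (_≤ d) (trans (sub-sub b₁ b₂ 0#) (+-identityʳ _)) (prefix 1 (ℕ.s≤s ℕ.z≤n) (ℕ.s≤s (ℕ.s≤s ℕ.z≤n)))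
    rest : PrefixBound (d - (b₁ - b₂)) bs
    rest k _ 2k≤ = shiftˡ (subst (_≤ d) (sub-sub b₁ b₂ _) longer)
      where
      longer : altSum (take (suc (suc (2 ℕ.* k))) (b₁ ∷ b₂ ∷ bs)) ≤ d
      longer = subst (λ j → altSum (take j (b₁ ∷ b₂ ∷ bs)) ≤ d) (ℕ.*-suc 2 k)
                 (prefix (suc k) (ℕ.s≤s ℕ.z≤n) (subst (ℕ._≤ suc (suc (length bs))) (sym (ℕ.*-suc 2 k)) (ℕ.s≤s (ℕ.s≤s 2k≤))))

  -- The bounds without slack, for any paired stalk.  A move at the head is
  -- answered by the opponent at the next vertex; a move in h is compared
  -- with the same move played on h alone.
  even-upper : ∀ {bs} → Paired bs → ∀ {n} {h : Board n} {y z} → Even n → IsVal h y → IsVal (st bs ⊕ h) z →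
               z ≤ y + altSum bs
  odd-lower : ∀ {bs} → Paired bs → ∀ {n} {h : Board n} {y z} → Odd n → IsVal h y → IsVal (st bs ⊕ h) z →
              y - altSum bs ≤ z
  even-upper-move : ∀ {bs} → Paired bs → ∀ {n} {h : Board n} {y x} → Even n → IsVal h y → MoveOutcome bs h x →
                    x ≤ y + altSum bs

  even-upper {bs} p {h = h} ev valh val with optimal-move bs h val
  ... | inj₁ move                  = even-upper-move p ev valh move
  ... | inj₂ (refl , refl , refl) = ≤-reflexive (sym (trans (+-identityʳ _) valh))

  even-upper-move (pair b₁ b₂ {bs} p) {h = h} {y} ev valh (head-move {y = y₁} val₁) with val-exists (st bs ⊕ h)
  ... | z₂ , val₂ = begin
      b₁ - y₁                     ≤⟨ -‿monoʳ-≤ b₁ (move≤value (head-move val₂) val₁) ⟩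
      b₁ - (b₂ - z₂)              ≡⟨ sub-sub b₁ b₂ z₂ ⟩
      (b₁ - b₂) + z₂              ≤⟨ +-monoʳ-≤ (b₁ - b₂) (even-upper p ev valh val₂) ⟩
      (b₁ - b₂) + (y + altSum bs) ≡⟨ x∙yz≈y∙xz (b₁ - b₂) y (altSum bs) ⟩
      y + ((b₁ - b₂) + altSum bs) ≡⟨ cong (y +_) (sub-sub b₁ b₂ (altSum bs)) ⟨
      y + altSum (b₁ ∷ b₂ ∷ bs)   ∎
    where open ≤-Reasoning
  even-upper-move {bs} p {y = y} ev valh (host-move {h = h} {u} {y₁} legal val₁) with val-exists (delete h u)
  ... | yᵤ , valᵤ = begin
      wt h u - y₁                ≤⟨ -‿monoʳ-≤ (wt h u) (odd-lower p (even-pred ev) valᵤ val₁) ⟩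
      wt h u - (yᵤ - altSum bs)  ≡⟨ sub-sub (wt h u) yᵤ (altSum bs) ⟩
      (wt h u - yᵤ) + altSum bs  ≤⟨ +-monoˡ-≤ (altSum bs) (proj₂ valh u yᵤ legal valᵤ) ⟩
      y + altSum bs              ∎
    where open ≤-Reasoning

  odd-lower p {zero} od = ⊥-elim (¬odd-zero od)
  odd-lower {bs} p {suc m} {h} {z = z} od ((u , legal , yᵤ , valᵤ , refl) , _) val with val-exists (st bs ⊕ delete h u)
  ... | z₁ , val₁ = begin
      (wt h u - yᵤ) - altSum bs  ≡⟨ sub-+ (wt h u) yᵤ (altSum bs) ⟩
      wt h u - (yᵤ + altSum bs)  ≤⟨ -‿monoʳ-≤ (wt h u) (even-upper p (odd-pred od) valᵤ val₁) ⟩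
      wt h u - z₁                ≤⟨ move≤value (host-move {bs} legal val₁) val ⟩
      z                          ∎
    where open ≤-Reasoning

  -- Now the head move is the one whose answer needs
  -- the prefix condition: it uses up b₁ - b₂ of the slack.
  even-lower : ∀ {d bs} → Bounded d bs → 0# ≤ d → ∀ {n} {h : Board n} {y z} → Even n → IsVal h y →
               IsVal (st bs ⊕ h) z → y + altSum bs ≤ z + (d + d)
  odd-upper : ∀ {d bs} → Bounded d bs → 0# ≤ d → ∀ {n} {h : Board n} {y z} → Odd n → IsVal h y →
              IsVal (st bs ⊕ h) z → z ≤ (y - altSum bs) + (d + d)
  odd-upper-move : ∀ {d bs} → Bounded d bs → 0# ≤ d → ∀ {n} {h : Board n} {y x} → Odd n → IsVal h y →
                   MoveOutcome bs h x → x ≤ (y - altSum bs) + (d + d)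

  even-lower {d} {bs} _ 0≤d {zero} {y = y} {z} _ valh val = begin
      y + altSum bs   ≡⟨ cong₂ _+_ valh (sym (stalk-value bs val)) ⟩
      0# + z          ≡⟨ +-identityˡ z ⟩
      z               ≡⟨ +-identityʳ z ⟨
      z + 0#          ≤⟨ +-monoʳ-≤ z (0≤-double 0≤d) ⟩
      z + (d + d)     ∎
    where open ≤-Reasoning
  even-lower {d} {bs} b 0≤d {suc m} {h} {z = z} ev ((u , legal , yᵤ , valᵤ , refl) , _) val
    with val-exists (st bs ⊕ delete h u)
  ... | z₁ , val₁ = begin
      (wt h u - yᵤ) + altSum bs                          ≡⟨ sub-sub (wt h u) yᵤ (altSum bs) ⟨
      wt h u - (yᵤ - altSum bs)                          ≡⟨ sub-+-cancel (wt h u) (yᵤ - altSum bs) (d + d) ⟨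
      (wt h u - ((yᵤ - altSum bs) + (d + d))) + (d + d)  ≤⟨ +-monoˡ-≤ (d + d) (-‿monoʳ-≤ (wt h u) (odd-upper b 0≤d (even-pred ev) valᵤ val₁)) ⟩
      (wt h u - z₁) + (d + d)                            ≤⟨ +-monoˡ-≤ (d + d) (move≤value (host-move {bs} legal val₁) val) ⟩
      z + (d + d)                                        ∎
    where open ≤-Reasoning

  odd-upper {bs = bs} b 0≤d {h = h} od valh val with optimal-move bs h val
  ... | inj₁ move           = odd-upper-move b 0≤d od valh move
  ... | inj₂ (_ , refl , _) = ⊥-elim (¬odd-zero od)

  odd-upper-move {d} (pair b₁ b₂ {bs} c≤d b) 0≤d {h = h} {y} od valh (head-move {y = y₁} val₁) with val-exists (st bs ⊕ h)
  ... | z₂ , val₂ = begin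
      b₁ - y₁                                        ≤⟨ -‿monoʳ-≤ b₁ (move≤value (head-move val₂) val₁) ⟩
      b₁ - (b₂ - z₂)                                 ≡⟨ sub-sub b₁ b₂ z₂ ⟩
      c + z₂                                         ≤⟨ +-monoʳ-≤ c (odd-upper b (0≤-of-≤ c≤d) od valh val₂) ⟩
      c + ((y - altSum bs) + ((d - c) + (d - c)))    ≡⟨ slack-shift c y (altSum bs) d ⟩
      (y - (c + altSum bs)) + (d + d)                ≡⟨ cong (λ t → (y - t) + (d + d)) (sub-sub b₁ b₂ (altSum bs)) ⟨
      (y - altSum (b₁ ∷ b₂ ∷ bs)) + (d + d)          ∎
    where
    open ≤-Reasoning
    c : Carrier
    c = b₁ - b₂
  odd-upper-move {d} {bs} b 0≤d {y = y} od valh (host-move {h = h} {u} {y₁} legal val₁) with val-exists (delete h u)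
  ... | yᵤ , valᵤ = begin
      wt h u - y₁                              ≡⟨ sub-+-cancel (wt h u) y₁ (d + d) ⟨
      (wt h u - (y₁ + (d + d))) + (d + d)      ≤⟨ +-monoˡ-≤ (d + d) (-‿monoʳ-≤ (wt h u) (even-lower b 0≤d (odd-pred od) valᵤ val₁)) ⟩
      (wt h u - (yᵤ + altSum bs)) + (d + d)    ≡⟨ cong (_+ (d + d)) (sub-+ (wt h u) yᵤ (altSum bs)) ⟨
      ((wt h u - yᵤ) - altSum bs) + (d + d)    ≤⟨ +-monoˡ-≤ (d + d) (+-monoˡ-≤ (- altSum bs) (proj₂ valh u yᵤ legal valᵤ)) ⟩
      (y - altSum bs) + (d + d)                ∎
    where open ≤-Reasoning

  add-altSum : ∀ y bs → y + altSum bs ≡ y - weight bs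
  add-altSum y bs = cong (y +_) (sym (⁻¹-involutive (altSum bs)))

  no-slack : ∀ z → z + (0# + 0#) ≡ z
  no-slack z = trans (cong (z +_) (+-identityʳ 0#)) (+-identityʳ z)

  even-value : ∀ {bs} → Paired bs → Bounded 0# bs → ∀ {n} {h : Board n} {y z} → Even n → IsVal h y →
               IsVal (st bs ⊕ h) z → z ≡ y + altSum bs
  even-value p b ev valh val =
    ≤-antisym (even-upper p ev valh val) (subst (_ ≤_) (no-slack _) (even-lower b ≤-refl ev valh val))

  odd-value : ∀ {bs} → Paired bs → Bounded 0# bs → ∀ {n} {h : Board n} {y z} → Odd n → IsVal h y →
              IsVal (st bs ⊕ h) z → z ≡ y - altSum bs
  odd-value p b od valh val =
    ≤-antisym (subst (_ ≤_) (no-slack _) (odd-upper b ≤-refl od valh val)) (odd-lower p od valh val)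

proposition2p1 : (𝔾 : OrdAbGroup) → let open Game 𝔾 in
    (as : List Carrier) → IsEvSeq as →
    ∀ {n} (h : Board n) → IsSimple h → (y : Carrier) → IsVal h y →
      (Even n → IsVal (st as ⊕ h) (y - weight as)
                × (∀ z → IsVal (st as ⊕ h) z → z ≡ y - weight as))
    × (Odd n → IsVal (st as ⊕ h) (y + weight as)
                × (∀ z → IsVal (st as ⊕ h) z → z ≡ y + weight as))
-- An ev-sequence is paired with even prefixes bounded by 0, so the values
-- are pinned down by even-value and odd-value.
proposition2p1 𝔾 as ((m , even-length) , prefix) h _ y valh =
  (λ ev → value-is (st as ⊕ h) λ val → trans (even-value p b ev valh val) (add-altSum y as)) ,
  (λ od → value-is (st as ⊕ h) λ val → odd-value p b od valh val)
  where
  open Game 𝔾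
  open EvStalk 𝔾
  p : Paired as
  p = paired as m even-length
  b : Bounded 0# as
  b = bounded p 0# prefix
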